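{- Let $\vec q=q_0,\dots,q_{k-1}$ be a list of propositional variables and $j<k$. There are $\mathsf{posELNDT}$ proofs over the extension axioms $\mathcal T$, of size polynomial in the size of the sequent, of $q_j\to t^{\vec q}_1$.
   Context: eNDT formulas: built from propositional variables, constants $0,1$ and extension variables by $\vee$ and decisions $\mathrm{dec}(A,p,B)$ ("if $p$ then $B$ else $A$", $p$ a propositional variable). $\mathrm{pd}(A,p,C):=\mathrm{dec}(A,p,A\vee C)$; positive formulas have only decisions of this form. An extension axiom $e\leftrightarrow A$ stands for sequents $e\to A$ and $A\to e$. Threshold axioms $\mathcal T$: for every list $\vec p$ of propositional variables and integer $k$, an extension variable $t^{\vec p}_k$, with axioms $t^{\epsilon}_0\leftrightarrow1$, $t^{\epsilon}_k\leftrightarrow0$ ($k\ne0$), $t^{p\vec p}_k\leftrightarrow\mathrm{pd}(t^{\vec p}_k,p,t^{\vec p}_{k-1})$ ($\epsilon$ empty list; $p\vec p$ = $\vec p$ with $p$ prepended). $\mathsf{posELNDT}$: sequents on multisets; initial sequents $0\to$, $\to1$, $p\to p$; cut; left/right weakening and contraction; $\vee$-left (from $\Gamma,A\to\Delta$ and $\Gamma,B\to\Delta$ infer $\Gamma,A\vee B\to\Delta$); $\vee$-right (from $\Gamma\to\Delta,A,B$ infer $\Gamma\to\Delta,A\vee B$); positive decision left (from $\Gamma,A\to\Delta$ and $\Gamma,p,B\to\Delta$ infer $\Gamma,\mathrm{pd}(A,p,B)\to\Delta$) and right (from $\Gamma\to\Delta,A,p$ and $\Gamma\to\Delta,A,B$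 infer $\Gamma\to\Delta,\mathrm{pd}(A,p,B)$); all formulas positive. A proof over a set of extension axioms: finite list of sequents, each an axiom sequent or derived by a rule (conclusion may contain extension variables). Size = number of symbols. -}

module Defs where

open import Data.Nat using (ℕ; zero; suc; _+_; _*_; _^_; _≤_)
open import Data.Integer as ℤ using (ℤ; 0ℤ; 1ℤ; ∣_∣)
open import Data.List using (List; []; _∷_; length; map; lookup)
open import Data.Nat.ListAction using (sum)
open import Data.List.Relation.Unary.All using (All)
open import Data.List.Relation.Unary.Any using (Any)
open import Data.List.Relation.Binary.Permutation.Propositional using (_↭_)
open import Data.Product using (Σ; ∃; _×_; _,_)
open import Data.Sum using (_⊎_)
open import Relation.Binary.PropositionalEquality using (_≡_; _≢_)

-- Extension variables: threshold variables t^{ps}_k, plus arbitrary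
-- further (axiom-free) extension variables.

data ExtVar : Set where
  tv   : List ℕ → ℤ → ExtVar
  evar : ℕ → ExtVar

data Fm : Set where
  var  : ℕ → Fm
  ext  : ExtVar → Fm
  𝟘 𝟙  : Fm
  _∨_  : Fm → Fm → Fm
  dec  : Fm → ℕ → Fm → Fm          -- dec(A,p,B): if p then B else A

infixr 6 _∨_

pd : Fm → ℕ → Fm → Fm
pd A p C = dec A p (A ∨ C)

t : List ℕ → ℤ → Fm
t ps k = ext (tv ps k)

data Pos : Fm → Set where
  pos-var : ∀ p → Pos (var p)
  pos-ext : ∀ e → Pos (ext e)
  pos-0   : Pos 𝟘
  pos-1   : Pos 𝟙
  pos-∨   : ∀ {A B} → Pos A → Pos B → Pos (A ∨ B)
  pos-pd  : ∀ {A C} p → Pos A → Pos C → Pos (pd A p C)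

-- size = number of symbols; an extension variable t^{ps}_k is written
-- with its index list ps and its (unary) index k.
extSize : ExtVar → ℕ
extSize (tv ps k) = 1 + length ps + ∣ k ∣
extSize (evar _)  = 1

fmSize : Fm → ℕ
fmSize (var _)     = 1
fmSize (ext e)     = extSize e
fmSize 𝟘           = 1
fmSize 𝟙           = 1
fmSize (A ∨ B)     = 1 + fmSize A + fmSize B
fmSize (dec A p B) = 2 + fmSize A + fmSize B

-- Sequents (antecedent and succedent are multisets, represented by
-- lists taken up to permutation).

record Seq : Set where
  constructor _⇒_
  field
    ante : List Fm
    succ : List Fm
open Seq public

infix 4 _⇒_

_≈ₛ_ : Seq → Seq → Set
S ≈ₛ S′ = (ante S ↭ ante S′) × (succ S ↭ succ S′)

seqSize : Seq → ℕ
seqSize (Γ ⇒ Δ) = 1 + sum (map fmSize Γ) + sum (map fmSize Δ)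

PosSeq : Seq → Set
PosSeq (Γ ⇒ Δ) = All Pos Γ × All Pos Δ

data ExtAx : ExtVar → Fm → Set where
  t-nil-0   : ExtAx (tv [] 0ℤ) 𝟙
  t-nil-k   : ∀ k → k ≢ 0ℤ → ExtAx (tv [] k) 𝟘
  t-cons    : ∀ p ps k →
              ExtAx (tv (p ∷ ps) k) (pd (t ps k) p (t ps (k ℤ.- 1ℤ)))

data TAxiom : Seq → Set where
  ax→ : ∀ {e A} → ExtAx e A → TAxiom (ext e ∷ [] ⇒ A ∷ [])
  ax← : ∀ {e A} → ExtAx e A → TAxiom (A ∷ [] ⇒ ext e ∷ [])

-- Rules of posELNDT: Rule premises conclusion (principal formulas at
-- the front; rule instances are matched up to permutation).

data Rule : List Seq → Seq → Set where
  init0  : Rule [] (𝟘 ∷ [] ⇒ [])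
  init1  : Rule [] ([] ⇒ 𝟙 ∷ [])
  initp  : ∀ p → Rule [] (var p ∷ [] ⇒ var p ∷ [])
  cut    : ∀ {Γ Δ} A →
           Rule ((Γ ⇒ A ∷ Δ) ∷ (A ∷ Γ ⇒ Δ) ∷ []) (Γ ⇒ Δ)
  wkL    : ∀ {Γ Δ} A → Rule ((Γ ⇒ Δ) ∷ []) (A ∷ Γ ⇒ Δ)
  wkR    : ∀ {Γ Δ} A → Rule ((Γ ⇒ Δ) ∷ []) (Γ ⇒ A ∷ Δ)
  ctrL   : ∀ {Γ Δ} A → Rule ((A ∷ A ∷ Γ ⇒ Δ) ∷ []) (A ∷ Γ ⇒ Δ)
  ctrR   : ∀ {Γ Δ} A → Rule ((Γ ⇒ A ∷ A ∷ Δ) ∷ []) (Γ ⇒ A ∷ Δ)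
  ∨L     : ∀ {Γ Δ} A B →
           Rule ((A ∷ Γ ⇒ Δ) ∷ (B ∷ Γ ⇒ Δ) ∷ []) (A ∨ B ∷ Γ ⇒ Δ)
  ∨R     : ∀ {Γ Δ} A B →
           Rule ((Γ ⇒ A ∷ B ∷ Δ) ∷ []) (Γ ⇒ A ∨ B ∷ Δ)
  pdL    : ∀ {Γ Δ} A p B →
           Rule ((A ∷ Γ ⇒ Δ) ∷ (var p ∷ B ∷ Γ ⇒ Δ) ∷ []) (pd A p B ∷ Γ ⇒ Δ)
  pdR    : ∀ {Γ Δ} A p B →
           Rule ((Γ ⇒ A ∷ var p ∷ Δ) ∷ (Γ ⇒ A ∷ B ∷ Δ) ∷ []) (Γ ⇒ pd A p B ∷ Δ)

Justified : List Seq → Seq → Set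
Justified L S =
  PosSeq S ×
  (TAxiom S ⊎
   Σ (List Seq) λ prems → Σ Seq λ concl →
     Rule prems concl × concl ≈ₛ S × All (λ P → Any (P ≈ₛ_) L) prems)

-- A proof, listed from the last line (head) back to the first.
data Derivation : List Seq → Set where
  []   : Derivation []
  _∷_  : ∀ {L S} → Justified L S → Derivation L → Derivation (S ∷ L)

proofSize : List Seq → ℕ
proofSize L = sum (map seqSize L)

ProvableWithin : ℕ → Seq → Set
ProvableWithin n S =
  Σ (List Seq) λ earlier → Derivation (S ∷ earlier) × proofSize (S ∷ earlier) ≤ n

-- Unfolding t^{p ps}_k ↔ pd(t^{ps}_k, p, t^{ps}_{k-1}) from right to left yields the two
-- monotonicity steps  t^{ps}_k ⊢ t^{p ps}_k  and  p, t^{ps}_{k-1} ⊢ t^{p ps}_k,  each a constant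
-- number of lines in the context q_j.  Peeling q_0, …, q_{j-1} off with the first step reduces
-- q_j ⊢ t^{q⃗}_1 to q_j ⊢ t^{q_j q_{j+1} …}_1, which the second step reduces to ⊢ t^{q_{j+1} …}_0,
-- and that follows from ⊢ 1 by the first step alone.  So the proof has O(k) lines, each with at
-- most three formulas of size O(k), hence size O(k²).
module Submission where

open import Defs
open import Data.Nat using (ℕ; _+_; _*_; _^_)
open import Data.Integer using (1ℤ)
open import Data.List using (List; []; _∷_; length; lookup)
open import Data.Fin using (Fin)
open import Data.Product using (∃)

open import Data.Bool using (T)
open import Data.Nat using (zero; suc; _≤_; _≤ᵇ_; z≤n; s≤s)
open import Data.Nat.Properties
open import Data.Nat.ListAction using (sum)
open import Data.Nat.Tactic.RingSolver using (solve-∀)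
open import Data.Integer as ℤ using (0ℤ; ∣_∣)
open import Data.Fin using (zero; suc)
open import Data.List using (map)
open import Data.List.Relation.Unary.All as All using (All; []; _∷_)
open import Data.List.Relation.Unary.Any using (Any; here; there)
open import Data.List.Relation.Binary.Permutation.Propositional using (↭-refl; ↭-swap)
open import Data.Product using (Σ; _,_; _×_)
open import Data.Sum using (_⊎_; inj₁; inj₂)
open import Function using (_∘′_)
open import Relation.Binary.PropositionalEquality using (_≡_; cong)

≈ₛ-refl : ∀ {S} → S ≈ₛ S
≈ₛ-refl = ↭-refl , ↭-refl

≈ₛ-swapˡ : ∀ {A B Γ Δ} → (A ∷ B ∷ Γ ⇒ Δ) ≈ₛ (B ∷ A ∷ Γ ⇒ Δ)
≈ₛ-swapˡ = ↭-swap _ _ ↭-refl , ↭-refl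

≈ₛ-swapʳ : ∀ {Γ A B Δ} → (Γ ⇒ A ∷ B ∷ Δ) ≈ₛ (Γ ⇒ B ∷ A ∷ Δ)
≈ₛ-swapʳ = ↭-refl , ↭-swap _ _ ↭-refl

sum-map-≤ : ∀ {A : Set} (f : A → ℕ) {b xs} →
            All (λ x → f x ≤ b) xs → sum (map f xs) ≤ length xs * b
sum-map-≤ f []         = z≤n
sum-map-≤ f (fx≤b ∷ p) = +-mono-≤ fx≤b (sum-map-≤ f p)

-- The formulas occurring in the proofs for lists of length at most w.
data Threshold (w : ℕ) : Fm → Set where
  threshold : ∀ {ps k} → length ps ≤ w → ∣ k ∣ ≤ 1 → Threshold w (t ps k)

data Small (w : ℕ) : Fm → Set where
  var      : ∀ p → Small w (var p)
  one      : Small w 𝟙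
  thr      : ∀ {A} → Threshold w A → Small w A
  decision : ∀ {A C} p → Threshold w A → Threshold w C → Small w (pd A p C)

formulaBound : ℕ → ℕ
formulaBound w = 3 * (3 + w)

lineBound : ℕ → ℕ
lineBound w = 1 + 3 * formulaBound w

threshold-pos : ∀ {w A} → Threshold w A → Pos A
threshold-pos (threshold _ _) = pos-ext _

small-pos : ∀ {w A} → Small w A → Pos A
small-pos (var p)          = pos-var p
small-pos one              = pos-1
small-pos (thr a)          = threshold-pos a
small-pos (decision p a c) = pos-pd p (threshold-pos a) (threshold-pos c)

threshold-size : ∀ {w A} → Threshold w A → fmSize A ≤ 2 + w
threshold-size {w} (threshold l≤w k≤1) =
  ≤-trans (+-mono-≤ (s≤s l≤w) k≤1) (≤-reflexive (+-comm (suc w) 1))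

small-size : ∀ {w A} → Small w A → fmSize A ≤ formulaBound w
small-size (var p)      = s≤s z≤n
small-size one          = s≤s z≤n
small-size {w} (thr a)  = ≤-trans (n≤1+n _) (≤-trans (s≤s (threshold-size a)) (m≤n*m (3 + w) 3))
small-size {w} (decision p a c) =
  ≤-trans (+-mono-≤ (+-monoʳ-≤ 2 (threshold-size a))
                    (+-mono-≤ (+-monoʳ-≤ 1 (threshold-size a)) (threshold-size c)))
          (≤-reflexive (pd-bound w))
  where
  pd-bound : ∀ w → 2 + (2 + w) + (1 + (2 + w) + (2 + w)) ≡ 3 * (3 + w)
  pd-bound = solve-∀

small-seqSize : ∀ {w Γ Δ} → All (Small w) Γ → All (Small w) Δ → length Γ + length Δ ≤ 3 →
                seqSize (Γ ⇒ Δ) ≤ lineBound w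
small-seqSize {w} {Γ} {Δ} sΓ sΔ n≤3 = s≤s (begin
  sum (map fmSize Γ) + sum (map fmSize Δ)         ≤⟨ +-mono-≤ (bound sΓ) (bound sΔ) ⟩
  length Γ * formulaBound w + length Δ * formulaBound w
                                                  ≡⟨ *-distribʳ-+ (formulaBound w) (length Γ) (length Δ) ⟨
  (length Γ + length Δ) * formulaBound w          ≤⟨ *-monoˡ-≤ (formulaBound w) n≤3 ⟩
  3 * formulaBound w                              ∎)
  where
  open ≤-Reasoning
  bound : ∀ {Θ} → All (Small w) Θ → sum (map fmSize Θ) ≤ length Θ * formulaBound w
  bound sΘ = sum-map-≤ fmSize (All.map small-size sΘ)

Inference : List Seq → Seq → Set
Inference L S =
  TAxiom S ⊎
  Σ (List Seq) λ prems → Σ Seq λ concl →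
    Rule prems concl × concl ≈ₛ S × All (λ P → Any (P ≈ₛ_) L) prems

by : ∀ {L S prems concl} → Rule prems concl → concl ≈ₛ S →
     All (λ P → Any (P ≈ₛ_) L) prems → Inference L S
by r concl≈S prems∈L = inj₂ (_ , _ , r , concl≈S , prems∈L)

module Proofs (w : ℕ) where

  record Lines (n : ℕ) (L : List Seq) : Set where
    constructor lines
    field
      derivation : Derivation L
      size       : proofSize L ≤ n * lineBound w

  Proof : ℕ → Seq → Set
  Proof n S = Σ (List Seq) λ L → Lines n (S ∷ L)

  proof⇒provable : ∀ {n S} → Proof n S → ProvableWithin (n * lineBound w) S
  proof⇒provable (L , lines d s) = L , d , s

  -- The side condition on the number of formulas is discharged by evaluation on concrete lines.
  extend : ∀ {n L Γ Δ} → Lines n L → All (Small w) Γ → All (Small w) Δ →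
           {T (length Γ + length Δ ≤ᵇ 3)} → Inference L (Γ ⇒ Δ) → Lines (suc n) ((Γ ⇒ Δ) ∷ L)
  extend {Γ = Γ} {Δ} (lines d s) sΓ sΔ {≤3} inf =
    lines (((All.map small-pos sΓ , All.map small-pos sΔ) , inf) ∷ d)
          (+-mono-≤ (small-seqSize sΓ sΔ (≤ᵇ⇒≤ (length Γ + length Δ) 3 ≤3)) s)

  ⊢𝟙 : ∀ {G} → Small w G → Proof 2 (G ∷ [] ⇒ 𝟙 ∷ [])
  ⊢𝟙 {G} sG = _ , G⇒𝟙
    where
    ⇒𝟙   = extend (lines [] z≤n) [] (one ∷ []) (by init1 ≈ₛ-refl [])
    G⇒𝟙 = extend ⇒𝟙 (sG ∷ []) (one ∷ []) (by (wkL G) ≈ₛ-refl (here ≈ₛ-refl ∷ []))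

  cut-axiom : ∀ {n G A e} → Small w G → Small w A → Small w (ext e) →
              TAxiom (A ∷ [] ⇒ ext e ∷ []) →
              Proof n (G ∷ [] ⇒ A ∷ []) → Proof (4 + n) (G ∷ [] ⇒ ext e ∷ [])
  cut-axiom {G = G} {A} {e} sG sA sE ax (_ , G⇒A) = _ , G⇒E
    where
    G⇒E,A = extend G⇒A (sG ∷ []) (sE ∷ sA ∷ []) (by (wkR (ext e)) ≈ₛ-refl (here ≈ₛ-refl ∷ []))
    A⇒E   = extend G⇒E,A (sA ∷ []) (sE ∷ []) (inj₁ ax)
    G,A⇒E = extend A⇒E (sG ∷ sA ∷ []) (sE ∷ []) (by (wkL G) ≈ₛ-refl (here ≈ₛ-refl ∷ []))
    G⇒E   = extend G,A⇒E (sG ∷ []) (sE ∷ [])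
              (by (cut A) ≈ₛ-refl (there (there (here ≈ₛ-swapʳ)) ∷ here ≈ₛ-swapˡ ∷ []))

  pd-introˡ : ∀ {n G A C} p → Small w G → Threshold w A → Threshold w C →
              Proof n (G ∷ [] ⇒ A ∷ []) → Proof (3 + n) (G ∷ [] ⇒ pd A p C ∷ [])
  pd-introˡ {A = A} {C} p sG tA tC (_ , G⇒A) = _ , G⇒P
    where
    G⇒p,A = extend G⇒A (sG ∷ []) (var p ∷ thr tA ∷ []) (by (wkR (var p)) ≈ₛ-refl (here ≈ₛ-refl ∷ []))
    G⇒C,A = extend G⇒p,A (sG ∷ []) (thr tC ∷ thr tA ∷ [])
              (by (wkR C) ≈ₛ-refl (there (here ≈ₛ-refl) ∷ []))
    G⇒P   = extend G⇒C,A (sG ∷ []) (decision p tA tC ∷ [])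
              (by (pdR A p C) ≈ₛ-refl (there (here ≈ₛ-swapʳ) ∷ here ≈ₛ-swapʳ ∷ []))

  pd-introʳ : ∀ {n A C} p → Threshold w A → Threshold w C →
              Proof n (var p ∷ [] ⇒ C ∷ []) → Proof (4 + n) (var p ∷ [] ⇒ pd A p C ∷ [])
  pd-introʳ {A = A} {C} p tA tC (_ , p⇒C) = _ , p⇒P
    where
    sp    = var p ∷ []
    p⇒p   = extend p⇒C sp sp (by (initp p) ≈ₛ-refl [])
    p⇒A,p = extend p⇒p sp (thr tA ∷ var p ∷ []) (by (wkR A) ≈ₛ-refl (here ≈ₛ-refl ∷ []))
    p⇒A,C = extend p⇒A,p sp (thr tA ∷ thr tC ∷ [])
              (by (wkR A) ≈ₛ-refl (there (there (here ≈ₛ-refl)) ∷ []))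
    p⇒P   = extend p⇒A,C sp (decision p tA tC ∷ [])
              (by (pdR A p C) ≈ₛ-refl (there (here ≈ₛ-refl) ∷ here ≈ₛ-refl ∷ []))

  t-cons-introˡ : ∀ {n G} p ps k → Small w G → length (p ∷ ps) ≤ w →
                  ∣ k ∣ ≤ 1 → ∣ k ℤ.- 1ℤ ∣ ≤ 1 →
                  Proof n (G ∷ [] ⇒ t ps k ∷ []) → Proof (7 + n) (G ∷ [] ⇒ t (p ∷ ps) k ∷ [])
  t-cons-introˡ p ps k sG l≤w k≤1 k-1≤1 =
    cut-axiom sG (decision p tₖ tₖ₋₁) (thr (threshold l≤w k≤1)) (ax← (t-cons p ps k))
      ∘′ pd-introˡ p sG tₖ tₖ₋₁
    where
    tₖ   = threshold (≤-trans (n≤1+n _) l≤w) k≤1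
    tₖ₋₁ = threshold (≤-trans (n≤1+n _) l≤w) k-1≤1

  t-cons-introʳ : ∀ {n} p ps k → length (p ∷ ps) ≤ w → ∣ k ∣ ≤ 1 → ∣ k ℤ.- 1ℤ ∣ ≤ 1 →
                  Proof n (var p ∷ [] ⇒ t ps (k ℤ.- 1ℤ) ∷ []) →
                  Proof (8 + n) (var p ∷ [] ⇒ t (p ∷ ps) k ∷ [])
  t-cons-introʳ p ps k l≤w k≤1 k-1≤1 =
    cut-axiom (var p) (decision p tₖ tₖ₋₁) (thr (threshold l≤w k≤1)) (ax← (t-cons p ps k))
      ∘′ pd-introʳ p tₖ tₖ₋₁
    where
    tₖ   = threshold (≤-trans (n≤1+n _) l≤w) k≤1
    tₖ₋₁ = threshold (≤-trans (n≤1+n _) l≤w) k-1≤1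

  ⊢t₀ : ∀ q ps → length ps ≤ w → Proof (6 + length ps * 7) (var q ∷ [] ⇒ t ps 0ℤ ∷ [])
  ⊢t₀ q []       _   = cut-axiom (var q) one (thr (threshold z≤n z≤n)) (ax← t-nil-0) (⊢𝟙 (var q))
  ⊢t₀ q (p ∷ ps) l≤w =
    t-cons-introˡ p ps 0ℤ (var q) l≤w z≤n ≤-refl (⊢t₀ q ps (≤-trans (n≤1+n _) l≤w))

  ⊢t₁ : ∀ ps (j : Fin (length ps)) → length ps ≤ w →
        Proof (suc (length ps) * 7) (var (lookup ps j) ∷ [] ⇒ t ps 1ℤ ∷ [])
  ⊢t₁ (q ∷ ps) zero    l≤w =
    t-cons-introʳ q ps 1ℤ l≤w ≤-refl z≤n (⊢t₀ q ps (≤-trans (n≤1+n _) l≤w))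
  ⊢t₁ (p ∷ ps) (suc j) l≤w =
    t-cons-introˡ p ps 1ℤ (var _) l≤w ≤-refl z≤n (⊢t₁ ps j (≤-trans (n≤1+n _) l≤w))

lineBound≤ : ∀ w → lineBound w ≤ 28 * suc w
lineBound≤ w = begin
  lineBound w   ≡⟨ lineBound-linear w ⟩
  28 + 9 * w    ≤⟨ +-monoʳ-≤ 28 (*-monoˡ-≤ w (m≤m+n 9 19)) ⟩
  28 + 28 * w   ≡⟨ *-suc 28 w ⟨
  28 * suc w    ∎
  where
  open ≤-Reasoning
  lineBound-linear : ∀ w → 1 + 3 * (3 * (3 + w)) ≡ 28 + 9 * w
  lineBound-linear = solve-∀

quadratic-size : ∀ w → suc w * 7 * lineBound w ≤ 196 * (suc w * suc w)
quadratic-size w = ≤-trans (*-monoʳ-≤ (suc w * 7) (lineBound≤ w)) (≤-reflexive (reorder (suc w)))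
  where
  reorder : ∀ m → m * 7 * (28 * m) ≡ 196 * (m * m)
  reorder = solve-∀

-- n is explicit: left to unification, n ^ c gets unfolded on the concrete sequent size.
square≤polynomial : ∀ c {m} n → 2 ≤ c → m ≤ n → c * (m * m) ≤ c * n ^ c + c
square≤polynomial c n 2≤c m≤n = ≤-trans (*-monoʳ-≤ c (square≤^ m≤n)) (m≤m+n _ c)
  where
  square≤^ : ∀ {m n} → m ≤ n → m * m ≤ n ^ c
  square≤^ {n = zero}  z≤n = z≤n
  square≤^ {n = suc n} m≤n = begin
    _                ≤⟨ *-mono-≤ m≤n m≤n ⟩
    suc n * suc n    ≡⟨ cong (suc n *_) (*-identityʳ (suc n)) ⟨
    suc n ^ 2        ≤⟨ ^-monoʳ-≤ (suc n) 2≤c ⟩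
    _                ∎
    where open ≤-Reasoning

ProvableWithin-mono : ∀ {m n S} → m ≤ n → ProvableWithin m S → ProvableWithin n S
ProvableWithin-mono m≤n (L , d , size) = L , d , ≤-trans size m≤n

fmSize≤seqSize : ∀ Γ A Δ → fmSize A ≤ seqSize (Γ ⇒ A ∷ Δ)
fmSize≤seqSize Γ A Δ = ≤-trans (m≤m+n (fmSize A) _) (m≤n+m _ (suc (sum (map fmSize Γ))))

mainTheorem20 : ∃ λ (c : ℕ) →
    (qs : List ℕ) (j : Fin (length qs)) →
      ProvableWithin (c * seqSize (var (lookup qs j) ∷ [] ⇒ t qs 1ℤ ∷ []) ^ c + c)
                     (var (lookup qs j) ∷ [] ⇒ t qs 1ℤ ∷ [])
mainTheorem20 = 196 , λ qs j →
  ProvableWithin-mono (bound qs (var (lookup qs j)))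
                      (Proofs.proof⇒provable (length qs) (Proofs.⊢t₁ (length qs) qs j ≤-refl))
  where
  bound : ∀ qs G → suc (length qs) * 7 * lineBound (length qs) ≤
                   196 * seqSize (G ∷ [] ⇒ t qs 1ℤ ∷ []) ^ 196 + 196
  bound qs G = ≤-trans (quadratic-size (length qs))
    (square≤polynomial 196 (seqSize (G ∷ [] ⇒ t qs 1ℤ ∷ [])) (s≤s (s≤s z≤n))
      (≤-trans (s≤s (m≤m+n (length qs) 1)) (fmSize≤seqSize (G ∷ []) (t qs 1ℤ) [])))
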